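{- The logic $\mathsf{ICK}\oplus((p\to q)\to(p>q))$ is sound and complete with respect to the class of conditional Kripke frames $(X,\le,\mathcal R)$ satisfying $R_a[x]\subseteq{\uparrow}x\cap a$ for all $x\in X$ and all upsets $a$ of $(X,\le)$.
   Context: Formulas: $\phi::=p\mid\bot\mid\phi\wedge\phi\mid\phi\vee\phi\mid\phi\to\phi\mid\phi>\phi$, $\top:=\bot\to\bot$. $\mathsf{ICK}\oplus\Gamma$ is the smallest set of formulas containing the axioms of intuitionistic propositional logic, $\Gamma$, $(p>(q\wedge r))\leftrightarrow((p>q)\wedge(p>r))$ and $(p>\top)\leftrightarrow\top$, closed under uniform substitution, modus ponens and: from $\phi\leftrightarrow\psi$ infer $(\phi>\chi)\leftrightarrow(\psi>\chi)$ and $(\chi>\phi)\leftrightarrow(\chi>\psi)$. A conditional Kripke frame is $(X,\le,\mathcal R)$, $(X,\le)$ a nonempty preorder, $\mathcal R=\{R_a: a\text{ upset}\}$ such that $x\le yR_az$ implies $xR_aw\le z$ for some $w$; $R_a[x]=\{y:xR_ay\}$, ${\uparrow}x=\{y:x\le y\}$. Valuations map variables to upsets; intuitionistic Kripke clauses and $x\models\phi>\psi$ iff every $y$ with $xR_{V(\phi)}y$ satisfies $\psi$. Sound and complete: the logic's members are exactly the formulas valid on all frames in the class. -}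

module Defs where

open import Level using (Level; _⊔_) renaming (suc to lsuc; zero to lzero)
open import Data.Nat using (ℕ)
open import Data.Product using (_×_; Σ; _,_; ∃)
open import Data.Sum using (_⊎_; inj₁; inj₂)
open import Data.Empty renaming (⊥ to Empty)
open import Function using (_⇔_)
open import Relation.Binary.PropositionalEquality using (_≡_)

infixr 6 _∧_
infixr 5 _∨_
infixr 4 _⇒_
infixr 4 _▷_

data Formula : Set where
  var  : ℕ → Formula
  ⊥    : Formula
  _∧_  : Formula → Formula → Formula
  _∨_  : Formula → Formula → Formula
  _⇒_  : Formula → Formula → Formula
  _▷_  : Formula → Formula → Formula

⊤ : Formula
⊤ = ⊥ ⇒ ⊥

_⇔F_ : Formula → Formula → Formula
φ ⇔F ψ = (φ ⇒ ψ) ∧ (ψ ⇒ φ)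

subst : (ℕ → Formula) → Formula → Formula
subst σ (var n) = σ n
subst σ ⊥ = ⊥
subst σ (φ ∧ ψ) = subst σ φ ∧ subst σ ψ
subst σ (φ ∨ ψ) = subst σ φ ∨ subst σ ψ
subst σ (φ ⇒ ψ) = subst σ φ ⇒ subst σ ψ
subst σ (φ ▷ ψ) = subst σ φ ▷ subst σ ψ

p q r : Formula
p = var 0
q = var 1
r = var 2

data ICK⊕_⊢_ (Γ : Formula → Set) : Formula → Set where
  ax-K   : ∀ φ ψ → ICK⊕ Γ ⊢ (φ ⇒ ψ ⇒ φ)
  ax-S   : ∀ φ ψ χ → ICK⊕ Γ ⊢ ((φ ⇒ ψ ⇒ χ) ⇒ (φ ⇒ ψ) ⇒ φ ⇒ χ)
  ax-∧E₁ : ∀ φ ψ → ICK⊕ Γ ⊢ (φ ∧ ψ ⇒ φ)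
  ax-∧E₂ : ∀ φ ψ → ICK⊕ Γ ⊢ (φ ∧ ψ ⇒ ψ)
  ax-∧I  : ∀ φ ψ → ICK⊕ Γ ⊢ (φ ⇒ ψ ⇒ φ ∧ ψ)
  ax-∨I₁ : ∀ φ ψ → ICK⊕ Γ ⊢ (φ ⇒ φ ∨ ψ)
  ax-∨I₂ : ∀ φ ψ → ICK⊕ Γ ⊢ (ψ ⇒ φ ∨ ψ)
  ax-∨E  : ∀ φ ψ χ → ICK⊕ Γ ⊢ ((φ ⇒ χ) ⇒ (ψ ⇒ χ) ⇒ φ ∨ ψ ⇒ χ)
  ax-⊥E  : ∀ φ → ICK⊕ Γ ⊢ (⊥ ⇒ φ)
  ax-Γ   : ∀ {φ} → Γ φ → ICK⊕ Γ ⊢ φ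
  ax-C∧  : ICK⊕ Γ ⊢ ((p ▷ (q ∧ r)) ⇔F ((p ▷ q) ∧ (p ▷ r)))
  ax-C⊤  : ICK⊕ Γ ⊢ ((p ▷ ⊤) ⇔F ⊤)
  usubst : ∀ {φ} (σ : ℕ → Formula) → ICK⊕ Γ ⊢ φ → ICK⊕ Γ ⊢ subst σ φ
  mp     : ∀ {φ ψ} → ICK⊕ Γ ⊢ (φ ⇒ ψ) → ICK⊕ Γ ⊢ φ → ICK⊕ Γ ⊢ ψ
  congˡ  : ∀ {φ ψ} χ → ICK⊕ Γ ⊢ (φ ⇔F ψ) → ICK⊕ Γ ⊢ ((φ ▷ χ) ⇔F (ψ ▷ χ))
  congʳ  : ∀ {φ ψ} χ → ICK⊕ Γ ⊢ (φ ⇔F ψ) → ICK⊕ Γ ⊢ ((χ ▷ φ) ⇔F (χ ▷ ψ))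

Γ-strict : Formula → Set
Γ-strict φ = φ ≡ ((p ⇒ q) ⇒ (p ▷ q))

record Upset {X : Set} (_≤_ : X → X → Set) : Set₁ where
  field
    pred : X → Set
    mono : ∀ {x y} → x ≤ y → pred x → pred y

record CKFrame : Set₁ where
  field
    X       : Set
    point   : X
    _≤_     : X → X → Set
    ≤-refl  : ∀ {x} → x ≤ x
    ≤-trans : ∀ {x y z} → x ≤ y → y ≤ z → x ≤ z
    R       : Upset _≤_ → X → X → Set
    -- R_a depends only on the extension of the set a
    R-ext   : ∀ (a b : Upset _≤_) → (∀ x → Upset.pred a x ⇔ Upset.pred b x) →
              ∀ x y → R a x y → R b x y
    back    : ∀ (a : Upset _≤_) {x y z} → x ≤ y → R a y z →
              Σ X (λ w → R a x w × w ≤ z)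

module Semantics (F : CKFrame) where
  open CKFrame F

  Valuation : Set₁
  Valuation = ℕ → Upset _≤_

  module _ (V : Valuation) where
    mutual
      _⊩_ : X → Formula → Set
      x ⊩ var n   = Upset.pred (V n) x
      x ⊩ ⊥       = Empty
      x ⊩ (φ ∧ ψ) = (x ⊩ φ) × (x ⊩ ψ)
      x ⊩ (φ ∨ ψ) = (x ⊩ φ) ⊎ (x ⊩ ψ)
      x ⊩ (φ ⇒ ψ) = ∀ y → x ≤ y → y ⊩ φ → y ⊩ ψ
      x ⊩ (φ ▷ ψ) = ∀ y → R ⟦ φ ⟧ x y → y ⊩ ψ

      ⟦_⟧ : Formula → Upset _≤_
      ⟦ φ ⟧ = record { pred = λ x → x ⊩ φ ; mono = persist φ }

      persist : ∀ φ {x y} → x ≤ y → x ⊩ φ → y ⊩ φ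
      persist (var n) x≤y h = Upset.mono (V n) x≤y h
      persist ⊥ x≤y ()
      persist (φ ∧ ψ) x≤y (h₁ , h₂) = persist φ x≤y h₁ , persist ψ x≤y h₂
      persist (φ ∨ ψ) x≤y (inj₁ h) = inj₁ (persist φ x≤y h)
      persist (φ ∨ ψ) x≤y (inj₂ h) = inj₂ (persist ψ x≤y h)
      persist (φ ⇒ ψ) x≤y h z y≤z hz = h z (≤-trans x≤y y≤z) hz
      persist (φ ▷ ψ) {x} {y} x≤y h z yRz with back ⟦ φ ⟧ x≤y yRz
      ... | w , xRw , w≤z = persist ψ w≤z (h w xRw)

Valid : CKFrame → Formula → Set₁
Valid F φ = ∀ (V : Valuation) x → _⊩_ V x φ
  where open Semantics F

StrictFrame : CKFrame → Set₁
StrictFrame F = ∀ (a : Upset _≤_) x y → R a x y → (x ≤ y) × Upset.pred a y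
  where open CKFrame F

-- Soundness is an induction on derivations; the strict axiom holds because the
-- R_a-successors of x lie in ↑x ∩ a. Completeness uses a canonical frame of prime
-- theories, built by a Lindenbaum construction over an enumeration of formulas
-- (this is where excluded middle enters), with x R_a y iff x ⊆ y, y ∈ a, and θ ∈ y
-- whenever χ > θ ∈ x for some χ with truth set a. In the truth lemma for φ > ψ, a
-- refuting successor of x is a prime extension of the φ-image {θ | φ > θ ∈ x} that
-- avoids ψ: the image is closed under derivation because φ > (·) respects modus
-- ponens and contains all theorems, and by the strict axiom it contains x and φ,
-- which makes the extension an R-successor of x.
module Submission where

open import Defs
open import Level using (Lift; lift; lower; 0ℓ)
open import Data.Product using (_×_; Σ; ∃; _,_; proj₁; proj₂)
open import Axiom.ExcludedMiddle using (ExcludedMiddle)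

open import Data.Bool using (Bool; T)
open import Data.Empty using (⊥-elim) renaming (⊥ to Empty)
open import Data.List using (List; []; _∷_; _++_; foldl; concatMap; cartesianProductWith)
open import Data.List.Membership.Propositional using (_∈_; lose)
open import Data.List.Membership.Propositional.Properties
  using (∈-++⁺ˡ; ∈-++⁺ʳ; ∈-concatMap⁺; ∈-cartesianProductWith⁺)
open import Data.List.Relation.Unary.Any using (here; there)
open import Data.Nat using (ℕ; zero; suc; _≤_; _≤′_; ≤′-refl; ≤′-step; _⊔_)
open import Data.Nat.Properties using (≤⇒≤′; m≤m⊔n; m≤n⊔m)
open import Data.Product.Function.NonDependent.Propositional using (_×-⇔_)
open import Data.Sum using (_⊎_; inj₁; inj₂)
import Data.Sum as Sum
open import Data.Sum.Function.Propositional using (_⊎-⇔_)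
open import Data.Unit using (tt) renaming (⊤ to Unit)
open import Function using (_⇔_; mk⇔; _∘_; id)
open import Function.Bundles using (Equivalence)
import Function.Properties.Equivalence as ⇔
open import Relation.Binary.PropositionalEquality using (_≡_; refl)
open import Relation.Nullary using (Dec; yes; no; ¬_)
open import Relation.Nullary.Decidable using (isYes; toWitness; fromWitness; map′)
open import Relation.Unary using (Pred; ∅; ｛_｝; _∪_; _⊆_)

open Equivalence using (to; from)

infixr 5 _∷ˢ_

_∷ˢ_ : Formula → (ℕ → Formula) → ℕ → Formula
(φ ∷ˢ σ) zero    = φ
(φ ∷ˢ σ) (suc n) = σ n

-- Soundness

module Soundness (F : CKFrame) where
  open CKFrame F
  open Semantics F

  valid-⇔ : ∀ {φ ψ} → Valid F (φ ⇔F ψ) → ∀ V x → _⊩_ V x φ ⇔ _⊩_ V x ψ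
  valid-⇔ v V x = mk⇔ (λ h → proj₁ (v V x) x ≤-refl h) (λ h → proj₂ (v V x) x ≤-refl h)

  ⊩-subst : ∀ σ V φ {x} → _⊩_ V x (subst σ φ) ⇔ _⊩_ (⟦_⟧ V ∘ σ) x φ
  ⊩-subst σ V (var n) = ⇔.refl
  ⊩-subst σ V ⊥       = ⇔.refl
  ⊩-subst σ V (φ ∧ ψ) = ⊩-subst σ V φ ×-⇔ ⊩-subst σ V ψ
  ⊩-subst σ V (φ ∨ ψ) = ⊩-subst σ V φ ⊎-⇔ ⊩-subst σ V ψ
  ⊩-subst σ V (φ ⇒ ψ) = mk⇔
    (λ h y x≤y a → to (⊩-subst σ V ψ) (h y x≤y (from (⊩-subst σ V φ) a)))
    (λ h y x≤y a → from (⊩-subst σ V ψ) (h y x≤y (to (⊩-subst σ V φ) a)))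
  ⊩-subst σ V (φ ▷ ψ) {x} = mk⇔
    (λ h y xRy → to (⊩-subst σ V ψ) (h y (R-ext ⟦φ⟧ᵛ ⟦σφ⟧ (λ _ → ⇔.sym (⊩-subst σ V φ)) x y xRy)))
    (λ h y xRy → from (⊩-subst σ V ψ) (h y (R-ext ⟦σφ⟧ ⟦φ⟧ᵛ (λ _ → ⊩-subst σ V φ) x y xRy)))
    where
    ⟦σφ⟧ = ⟦_⟧ V (subst σ φ)
    ⟦φ⟧ᵛ = ⟦_⟧ (⟦_⟧ V ∘ σ) φ

  sound : ∀ {Γ} → (∀ {φ} → Γ φ → Valid F φ) → ∀ {φ} → ICK⊕ Γ ⊢ φ → Valid F φ
  sound Γ-valid (ax-K φ ψ)     V x = λ y _ h z y≤z _ → persist V φ y≤z h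
  sound Γ-valid (ax-S φ ψ χ)   V x = λ y _ f z y≤z g w z≤w h →
    f w (≤-trans y≤z z≤w) h w ≤-refl (g w z≤w h)
  sound Γ-valid (ax-∧E₁ φ ψ)   V x = λ y _ → proj₁
  sound Γ-valid (ax-∧E₂ φ ψ)   V x = λ y _ → proj₂
  sound Γ-valid (ax-∧I φ ψ)    V x = λ y _ h z y≤z g → persist V φ y≤z h , g
  sound Γ-valid (ax-∨I₁ φ ψ)   V x = λ y _ → inj₁
  sound Γ-valid (ax-∨I₂ φ ψ)   V x = λ y _ → inj₂
  sound Γ-valid (ax-∨E φ ψ χ)  V x = λ y _ f z y≤z g w z≤w →
    Sum.[ f w (≤-trans y≤z z≤w) , g w z≤w ]
  sound Γ-valid (ax-⊥E φ)      V x = λ y _ ()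
  sound Γ-valid (ax-Γ γ)       = Γ-valid γ
  sound Γ-valid ax-C∧          V x =
    (λ y _ h → (λ z yRz → proj₁ (h z yRz)) , (λ z yRz → proj₂ (h z yRz))) ,
    (λ y _ h z yRz → proj₁ h z yRz , proj₂ h z yRz)
  sound Γ-valid ax-C⊤          V x = (λ y _ _ z _ ()) , (λ y _ _ z _ w _ ())
  sound Γ-valid (usubst {φ} σ d) V x = from (⊩-subst σ V φ) (sound Γ-valid d (⟦_⟧ V ∘ σ) x)
  sound Γ-valid (mp d e)       V x = sound Γ-valid d V x x ≤-refl (sound Γ-valid e V x)
  sound Γ-valid (congˡ {φ} {ψ} χ d) V x =
    (λ y _ h z yRz → h z (R-ext (⟦_⟧ V ψ) (⟦_⟧ V φ) (λ w → ⇔.sym (φ⇔ψ w)) y z yRz)) ,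
    (λ y _ h z yRz → h z (R-ext (⟦_⟧ V φ) (⟦_⟧ V ψ) φ⇔ψ y z yRz))
    where φ⇔ψ = valid-⇔ {φ} {ψ} (sound Γ-valid d) V
  sound Γ-valid (congʳ {φ} {ψ} χ d) V x =
    (λ y _ h z yRz → to (φ⇔ψ z) (h z yRz)) ,
    (λ y _ h z yRz → from (φ⇔ψ z) (h z yRz))
    where φ⇔ψ = valid-⇔ {φ} {ψ} (sound Γ-valid d) V

  strict-axiom-valid : StrictFrame F → ∀ {φ} → Γ-strict φ → Valid F φ
  strict-axiom-valid strict refl V x y _ f z yRz =
    f z (proj₁ (strict _ y z yRz)) (proj₂ (strict _ y z yRz))

strict-sound : ∀ {φ} → ICK⊕ Γ-strict ⊢ φ → ∀ F → StrictFrame F → Valid F φ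
strict-sound d F strict = sound (strict-axiom-valid strict) d
  where open Soundness F

Γ-strict-consistent : ¬ ICK⊕ Γ-strict ⊢ ⊥
Γ-strict-consistent d = strict-sound d point-frame (λ _ _ _ ()) (λ _ → all) tt
  where
  point-frame : CKFrame
  point-frame = record
    { X = Unit ; point = tt ; _≤_ = λ _ _ → Unit ; ≤-refl = tt ; ≤-trans = λ _ _ → tt
    ; R = λ _ _ _ → Empty ; R-ext = λ _ _ _ _ _ () ; back = λ _ _ () }
  all : Upset (CKFrame._≤_ point-frame)
  all = record { pred = λ _ → Unit ; mono = λ _ _ → tt }

-- An enumeration of all formulas

connectives : List (Formula → Formula → Formula)
connectives = _∧_ ∷ _∨_ ∷ _⇒_ ∷ _▷_ ∷ []

combinations : List Formula → (Formula → Formula → Formula) → List Formula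
combinations Fs _∙_ = cartesianProductWith _∙_ Fs Fs

enumeration : ℕ → List Formula
enumeration zero    = ⊥ ∷ []
enumeration (suc n) =
  var n ∷ enumeration n ++ concatMap (combinations (enumeration n)) connectives

enumeration-mono : ∀ {k l φ} → k ≤ l → φ ∈ enumeration k → φ ∈ enumeration l
enumeration-mono = go ∘ ≤⇒≤′
  where
  go : ∀ {k l φ} → k ≤′ l → φ ∈ enumeration k → φ ∈ enumeration l
  go ≤′-refl        = id
  go (≤′-step k≤′l) = there ∘ ∈-++⁺ˡ ∘ go k≤′l

enumerated : Formula → Set
enumerated φ = ∃ λ k → φ ∈ enumeration k

enumerated-binary : ∀ {_∙_ φ ψ} → _∙_ ∈ connectives →
  enumerated φ → enumerated ψ → enumerated (φ ∙ ψ)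
enumerated-binary {_∙_} ∙∈ (k , φ∈) (l , ψ∈) =
  suc (k ⊔ l) , there (∈-++⁺ʳ Fs (∈-concatMap⁺ (combinations Fs) (lose ∙∈ φ∙ψ∈)))
  where
  Fs = enumeration (k ⊔ l)
  φ∙ψ∈ = ∈-cartesianProductWith⁺ _∙_
    (enumeration-mono (m≤m⊔n k l) φ∈) (enumeration-mono (m≤n⊔m k l) ψ∈)

enumeration-complete : ∀ φ → enumerated φ
enumeration-complete (var n) = suc n , here refl
enumeration-complete ⊥       = zero , here refl
enumeration-complete (φ ∧ ψ) = enumerated-binary (here refl)
  (enumeration-complete φ) (enumeration-complete ψ)
enumeration-complete (φ ∨ ψ) = enumerated-binary (there (here refl))
  (enumeration-complete φ) (enumeration-complete ψ)
enumeration-complete (φ ⇒ ψ) = enumerated-binary (there (there (here refl)))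
  (enumeration-complete φ) (enumeration-complete ψ)
enumeration-complete (φ ▷ ψ) = enumerated-binary (there (there (there (here refl))))
  (enumeration-complete φ) (enumeration-complete ψ)

-- Derivations from a set of hypotheses

module Derivations (Λ : Pred Formula 0ℓ) where

  Thm : Formula → Set
  Thm = ICK⊕ Λ ⊢_

  infix 4 _⊢ₕ_

  data _⊢ₕ_ (P : Pred Formula 0ℓ) : Formula → Set where
    hyp : ∀ {φ} → P φ → P ⊢ₕ φ
    thm : ∀ {φ} → Thm φ → P ⊢ₕ φ
    app : ∀ {φ ψ} → P ⊢ₕ (φ ⇒ ψ) → P ⊢ₕ φ → P ⊢ₕ ψ

  module _ {P : Pred Formula 0ℓ} where

    ⊢ₕ-mono : ∀ {Q φ} → P ⊆ Q → P ⊢ₕ φ → Q ⊢ₕ φ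
    ⊢ₕ-mono P⊆Q (hyp h)   = hyp (P⊆Q h)
    ⊢ₕ-mono P⊆Q (thm t)   = thm t
    ⊢ₕ-mono P⊆Q (app d e) = app (⊢ₕ-mono P⊆Q d) (⊢ₕ-mono P⊆Q e)

    ⇒-intro-const : ∀ {φ ψ} → P ⊢ₕ ψ → P ⊢ₕ (φ ⇒ ψ)
    ⇒-intro-const {φ} {ψ} = app (thm (ax-K ψ φ))

    ∧-intro : ∀ {φ ψ} → P ⊢ₕ φ → P ⊢ₕ ψ → P ⊢ₕ (φ ∧ ψ)
    ∧-intro {φ} {ψ} d e = app (app (thm (ax-∧I φ ψ)) d) e

    ∧-elim₁ : ∀ {φ ψ} → P ⊢ₕ (φ ∧ ψ) → P ⊢ₕ φ
    ∧-elim₁ {φ} {ψ} = app (thm (ax-∧E₁ φ ψ))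

    ∧-elim₂ : ∀ {φ ψ} → P ⊢ₕ (φ ∧ ψ) → P ⊢ₕ ψ
    ∧-elim₂ {φ} {ψ} = app (thm (ax-∧E₂ φ ψ))

  ⇒-refl : ∀ φ → Thm (φ ⇒ φ)
  ⇒-refl φ = mp (mp (ax-S φ (φ ⇒ φ) φ) (ax-K φ (φ ⇒ φ))) (ax-K φ φ)

  deduction : ∀ {P χ φ} → (P ∪ ｛ χ ｝) ⊢ₕ φ → P ⊢ₕ (χ ⇒ φ)
  deduction (hyp (inj₁ h))             = ⇒-intro-const (hyp h)
  deduction {χ = χ} (hyp (inj₂ refl)) = thm (⇒-refl χ)
  deduction (thm t)                    = ⇒-intro-const (thm t)
  deduction {χ = χ} (app {φ} {ψ} d e) =
    app (app (thm (ax-S χ φ ψ)) (deduction d)) (deduction e)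

  cut : ∀ {P χ φ} → (P ∪ ｛ χ ｝) ⊢ₕ φ → P ⊢ₕ χ → P ⊢ₕ φ
  cut = app ∘ deduction

  theorem : ∀ {φ} → ∅ ⊢ₕ φ → Thm φ
  theorem (hyp ())
  theorem (thm t)   = t
  theorem (app d e) = mp (theorem d) (theorem e)

  ▷-∧ : ∀ φ ψ χ → Thm ((φ ▷ (ψ ∧ χ)) ⇔F ((φ ▷ ψ) ∧ (φ ▷ χ)))
  ▷-∧ φ ψ χ = usubst (φ ∷ˢ ψ ∷ˢ χ ∷ˢ var) ax-C∧

  -- Via φ ▷ (χ ∧ (χ ⇒ ψ)), which is rewritten to φ ▷ ((χ ∧ (χ ⇒ ψ)) ∧ ψ) by congʳ.
  ▷-mp : ∀ {P φ χ ψ} → P ⊢ₕ (φ ▷ (χ ⇒ ψ)) → P ⊢ₕ (φ ▷ χ) → P ⊢ₕ (φ ▷ ψ)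
  ▷-mp {φ = φ} {χ} {ψ} d e =
    ∧-elim₂ (app (∧-elim₁ (thm (▷-∧ φ A ψ))) (app (∧-elim₁ (thm (congʳ φ A⇔A∧ψ))) φ▷A))
    where
    A : Formula
    A = χ ∧ (χ ⇒ ψ)

    φ▷A = app (∧-elim₂ (thm (▷-∧ φ χ (χ ⇒ ψ)))) (∧-intro e d)

    assumption : ∀ {χ} → (∅ ∪ ｛ χ ｝) ⊢ₕ χ
    assumption = hyp (inj₂ refl)

    A⇔A∧ψ : Thm (A ⇔F (A ∧ ψ))
    A⇔A∧ψ = theorem (∧-intro
      (deduction (∧-intro assumption (app (∧-elim₂ assumption) (∧-elim₁ assumption))))
      (deduction (∧-elim₁ assumption)))

  -- Prime theories and the Lindenbaum lemma

  record IsPrimeTheory (Q : Pred Formula 0ℓ) : Set where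
    field
      closed     : ∀ {φ} → Q ⊢ₕ φ → Q φ
      consistent : ¬ Q ⊥
      prime      : ∀ {φ ψ} → Q (φ ∨ ψ) → Q φ ⊎ Q ψ

  -- Membership is Bool-valued so that prime theories form a small type,
  -- as the carrier of a frame must.
  record PrimeTheory : Set where
    field
      mem           : Formula → Bool
      isPrimeTheory : IsPrimeTheory (T ∘ mem)

    open IsPrimeTheory isPrimeTheory public

  infix 4 _∋_

  _∋_ : PrimeTheory → Formula → Set
  x ∋ φ = T (PrimeTheory.mem x φ)

  open PrimeTheory public using (closed; consistent; prime)

  ∋-∧ : ∀ x {φ ψ} → (x ∋ φ × x ∋ ψ) ⇔ x ∋ (φ ∧ ψ)
  ∋-∧ x = mk⇔
    (λ (φ∈ , ψ∈) → closed x (∧-intro (hyp φ∈) (hyp ψ∈)))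
    (λ φ∧ψ∈ → closed x (∧-elim₁ (hyp φ∧ψ∈)) , closed x (∧-elim₂ (hyp φ∧ψ∈)))

  ∋-∨ : ∀ x {φ ψ} → (x ∋ φ ⊎ x ∋ ψ) ⇔ x ∋ (φ ∨ ψ)
  ∋-∨ x {φ} {ψ} = mk⇔
    Sum.[ (λ φ∈ → closed x (app (thm (ax-∨I₁ φ ψ)) (hyp φ∈)))
        , (λ ψ∈ → closed x (app (thm (ax-∨I₂ φ ψ)) (hyp ψ∈))) ]
    (prime x)

  module Classical (dec : (A : Set) → Dec A) where

    toPrimeTheory : ∀ {Q} → IsPrimeTheory Q → PrimeTheory
    toPrimeTheory {Q} isPT = record
      { mem           = isYes ∘ dec ∘ Q
      ; isPrimeTheory = record
        { closed     = λ d → fromWitness (P.closed (⊢ₕ-mono toWitness d))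
        ; consistent = P.consistent ∘ toWitness
        ; prime      = Sum.map fromWitness fromWitness ∘ P.prime ∘ toWitness
        }
      }
      where module P = IsPrimeTheory isPT

    module Lindenbaum {P : Pred Formula 0ℓ} {ψ : Formula} (P⊬ψ : ¬ P ⊢ₕ ψ) where

      extend : Pred Formula 0ℓ → Formula → Pred Formula 0ℓ
      extend Q χ = Q ∪ (λ φ → χ ≡ φ × ¬ (Q ∪ ｛ χ ｝) ⊢ₕ ψ)

      extendAll : Pred Formula 0ℓ → List Formula → Pred Formula 0ℓ
      extendAll = foldl extend

      ⊆-extendAll : ∀ {Q} L → Q ⊆ extendAll Q L
      ⊆-extendAll []      = id
      ⊆-extendAll (χ ∷ L) = ⊆-extendAll L ∘ inj₁

      extend-⊬ : ∀ {Q} χ → ¬ Q ⊢ₕ ψ → ¬ extend Q χ ⊢ₕ ψ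
      extend-⊬ {Q} χ Q⊬ψ d = Q⊬ψ (⊢ₕ-mono (Sum.[ id , (λ (_ , ⊬) → ⊥-elim (⊬ d′)) ]) d)
        where
        d′ : (Q ∪ ｛ χ ｝) ⊢ₕ ψ
        d′ = ⊢ₕ-mono (Sum.map₂ proj₁) d

      extendAll-⊬ : ∀ {Q} L → ¬ Q ⊢ₕ ψ → ¬ extendAll Q L ⊢ₕ ψ
      extendAll-⊬ []      = id
      extendAll-⊬ (χ ∷ L) = extendAll-⊬ L ∘ extend-⊬ χ

      extendAll-decides : ∀ {Q χ} L → χ ∈ L → extendAll Q L χ ⊎ (extendAll Q L ∪ ｛ χ ｝) ⊢ₕ ψ
      extendAll-decides {Q} (χ ∷ L) (here refl) with dec ((Q ∪ ｛ χ ｝) ⊢ₕ ψ)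
      ... | yes d = inj₂ (⊢ₕ-mono (Sum.map₁ (⊆-extendAll L ∘ inj₁)) d)
      ... | no ⊬  = inj₁ (⊆-extendAll L (inj₂ (refl , ⊬)))
      extendAll-decides (χ′ ∷ L) (there χ∈L) = extendAll-decides L χ∈L

      stage : ℕ → Pred Formula 0ℓ
      stage zero    = P
      stage (suc k) = extendAll (stage k) (enumeration k)

      stage-mono : ∀ {k l} → k ≤ l → stage k ⊆ stage l
      stage-mono = go ∘ ≤⇒≤′
        where
        go : ∀ {k l} → k ≤′ l → stage k ⊆ stage l
        go ≤′-refl            = id
        go (≤′-step {l} k≤′l) = ⊆-extendAll (enumeration l) ∘ go k≤′l

      stage-⊬ : ∀ k → ¬ stage k ⊢ₕ ψ
      stage-⊬ zero    = P⊬ψ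
      stage-⊬ (suc k) = extendAll-⊬ (enumeration k) (stage-⊬ k)

      limit : Pred Formula 0ℓ
      limit φ = ∃ λ k → stage k φ

      limit-compact : ∀ {φ} → limit ⊢ₕ φ → ∃ λ k → stage k ⊢ₕ φ
      limit-compact (hyp (k , h)) = k , hyp h
      limit-compact (thm t)       = zero , thm t
      limit-compact (app d e) with limit-compact d | limit-compact e
      ... | k , d′ | l , e′ =
        k ⊔ l , app (⊢ₕ-mono (stage-mono (m≤m⊔n k l)) d′) (⊢ₕ-mono (stage-mono (m≤n⊔m k l)) e′)

      limit-⊬ : ¬ limit ⊢ₕ ψ
      limit-⊬ d = let k , d′ = limit-compact d in stage-⊬ k d′

      limit-decides : ∀ χ → limit χ ⊎ (limit ∪ ｛ χ ｝) ⊢ₕ ψ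
      limit-decides χ with enumeration-complete χ
      ... | k , χ∈Ek = Sum.map (suc k ,_) (⊢ₕ-mono (Sum.map₁ (suc k ,_)))
                         (extendAll-decides (enumeration k) χ∈Ek)

      limit-isPrimeTheory : IsPrimeTheory limit
      limit-isPrimeTheory = record
        { closed = limit-closed ; consistent = limit-consistent ; prime = limit-prime }
        where
        limit-closed : ∀ {φ} → limit ⊢ₕ φ → limit φ
        limit-closed {φ} d with limit-decides φ
        ... | inj₁ φ∈ = φ∈
        ... | inj₂ e  = ⊥-elim (limit-⊬ (cut e d))

        limit-consistent : ¬ limit ⊥
        limit-consistent h = limit-⊬ (app (thm (ax-⊥E ψ)) (hyp h))

        limit-prime : ∀ {φ χ} → limit (φ ∨ χ) → limit φ ⊎ limit χ
        limit-prime {φ} {χ} h with limit-decides φ | limit-decides χ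
        ... | inj₁ φ∈ | _      = inj₁ φ∈
        ... | inj₂ _  | inj₁ χ∈ = inj₂ χ∈
        ... | inj₂ dφ | inj₂ dχ = ⊥-elim (limit-⊬
              (app (app (app (thm (ax-∨E φ χ ψ)) (deduction dφ)) (deduction dχ)) (hyp h)))

    lindenbaum : ∀ {P ψ} → ¬ P ⊢ₕ ψ → Σ PrimeTheory λ x → P ⊆ (x ∋_) × ¬ x ∋ ψ
    lindenbaum P⊬ψ =
      toPrimeTheory limit-isPrimeTheory ,
      (λ h → fromWitness (zero , h)) ,
      (λ ψ∈ → limit-⊬ (hyp (toWitness ψ∈)))
      where open Lindenbaum P⊬ψ

    derivable-from-extensions : ∀ {P ψ} → (∀ x → P ⊆ (x ∋_) → x ∋ ψ) → P ⊢ₕ ψ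
    derivable-from-extensions {P} {ψ} in-all with dec (P ⊢ₕ ψ)
    ... | yes d = d
    ... | no ⊬  = let x , P⊆x , ψ∉x = lindenbaum ⊬ in ⊥-elim (ψ∉x (in-all x P⊆x))

    canonical-⇒ : ∀ {φ ψ} → (∀ x → x ∋ φ → x ∋ ψ) → Thm (φ ⇒ ψ)
    canonical-⇒ φ⊆ψ =
      theorem (deduction (derivable-from-extensions λ x φ∈ → φ⊆ψ x (φ∈ (inj₂ refl))))

    canonical-⇔ : ∀ {φ ψ} → (∀ x → x ∋ φ ⇔ x ∋ ψ) → Thm (φ ⇔F ψ)
    canonical-⇔ φ⇔ψ =
      theorem (∧-intro (thm (canonical-⇒ (to ∘ φ⇔ψ))) (thm (canonical-⇒ (from ∘ φ⇔ψ))))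

-- The canonical strict frame

module Completeness (dec : (A : Set) → Dec A) where
  open Derivations Γ-strict
  open Classical dec

  strict : ∀ φ ψ → Thm ((φ ⇒ ψ) ⇒ (φ ▷ ψ))
  strict φ ψ = usubst (φ ∷ˢ ψ ∷ˢ var) (ax-Γ refl)

  ▷-intro : ∀ {P φ ψ} → P ⊢ₕ ψ → P ⊢ₕ (φ ▷ ψ)
  ▷-intro {φ = φ} {ψ} = app (thm (strict φ ψ)) ∘ ⇒-intro-const

  _⊑_ : PrimeTheory → PrimeTheory → Set
  x ⊑ y = (x ∋_) ⊆ (y ∋_)

  canonicalR : Upset _⊑_ → PrimeTheory → PrimeTheory → Set
  canonicalR a x y = x ⊑ y × Upset.pred a y ×
    (∀ χ θ → (∀ z → Upset.pred a z ⇔ z ∋ χ) → x ∋ (χ ▷ θ) → y ∋ θ)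

  canonical : CKFrame
  canonical = record
    { X       = PrimeTheory
    ; point   = proj₁ (lindenbaum {P = ∅} {ψ = ⊥} (Γ-strict-consistent ∘ theorem))
    ; _≤_     = _⊑_
    ; ≤-refl  = id
    ; ≤-trans = λ x⊑y y⊑z → y⊑z ∘ x⊑y
    ; R       = canonicalR
    ; R-ext   = λ a b a⇔b x y (x⊑y , ya , f) →
        x⊑y , to (a⇔b y) ya , (λ χ θ b⇔χ → f χ θ (λ z → ⇔.trans (a⇔b z) (b⇔χ z)))
    ; back    = λ a {z = z} x⊑y (y⊑z , za , f) →
        z , (y⊑z ∘ x⊑y , za , (λ χ θ e → f χ θ e ∘ x⊑y)) , id
    }

  canonical-strict : StrictFrame canonical
  canonical-strict a x y (x⊑y , ya , _) = x⊑y , ya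

  open Semantics canonical

  V : Valuation
  V n = record { pred = _∋ var n ; mono = λ x⊑y → x⊑y }

  _⊨_ : PrimeTheory → Formula → Set
  x ⊨ φ = _⊩_ V x φ

  ▷-image : PrimeTheory → Formula → Pred Formula 0ℓ
  ▷-image x φ θ = x ∋ (φ ▷ θ)

  ▷-image-closed : ∀ x {φ θ} → ▷-image x φ ⊢ₕ θ → x ∋ (φ ▷ θ)
  ▷-image-closed x (hyp h)   = h
  ▷-image-closed x (thm t)   = closed x (▷-intro (thm t))
  ▷-image-closed x (app d e) =
    closed x (▷-mp (hyp (▷-image-closed x d)) (hyp (▷-image-closed x e)))

  ⊆-▷-image : ∀ x {φ} → (x ∋_) ⊆ ▷-image x φ
  ⊆-▷-image x h = closed x (▷-intro (hyp h))

  ∈-▷-image : ∀ x {φ} → ▷-image x φ φ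
  ∈-▷-image x {φ} = closed x (app (thm (strict φ φ)) (thm (⇒-refl φ)))

  ▷-congˡ-canonical : ∀ x {χ φ θ} → (∀ z → z ∋ χ ⇔ z ∋ φ) → x ∋ (χ ▷ θ) → x ∋ (φ ▷ θ)
  ▷-congˡ-canonical x {θ = θ} χ⇔φ χ▷θ∈ =
    closed x (app (∧-elim₁ (thm (congˡ θ (canonical-⇔ χ⇔φ)))) (hyp χ▷θ∈))

  module _ {φ ψ} (IHφ : ∀ x → x ⊨ φ ⇔ x ∋ φ) (IHψ : ∀ x → x ⊨ ψ ⇔ x ∋ ψ) where

    truth-⇒ : ∀ x → x ⊨ (φ ⇒ ψ) ⇔ x ∋ (φ ⇒ ψ)
    truth-⇒ x = mk⇔
      (λ h → closed x (deduction (derivable-from-extensions λ y x,φ⊆y →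
        to (IHψ y) (h y (λ {_} χ∈ → x,φ⊆y (inj₁ χ∈)) (from (IHφ y) (x,φ⊆y (inj₂ refl)))))))
      (λ φ⇒ψ∈ y x⊑y φ⊨ → from (IHψ y) (closed y (app (hyp (x⊑y φ⇒ψ∈)) (hyp (to (IHφ y) φ⊨)))))

    truth-▷ : ∀ x → x ⊨ (φ ▷ ψ) ⇔ x ∋ (φ ▷ ψ)
    truth-▷ x = mk⇔
      (λ h → ▷-image-closed x (derivable-from-extensions λ y image⊆y →
        to (IHψ y) (h y (canonicalR-from-▷-image image⊆y))))
      (λ φ▷ψ∈ y (_ , _ , f) → from (IHψ y) (f φ ψ IHφ φ▷ψ∈))
      where
      canonicalR-from-▷-image : ∀ {y} → ▷-image x φ ⊆ (y ∋_) → canonicalR (⟦_⟧ V φ) x y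
      canonicalR-from-▷-image {y} image⊆y =
        (λ {_} χ∈ → image⊆y (⊆-▷-image x χ∈)) ,
        from (IHφ y) (image⊆y (∈-▷-image x)) ,
        (λ χ θ φ⇔χ → image⊆y ∘ ▷-congˡ-canonical x (λ z → ⇔.trans (⇔.sym (φ⇔χ z)) (IHφ z)))

  truth : ∀ φ x → x ⊨ φ ⇔ x ∋ φ
  truth (var n) x = ⇔.refl
  truth ⊥       x = mk⇔ (λ ()) (⊥-elim ∘ consistent x)
  truth (φ ∧ ψ) x = ⇔.trans (truth φ x ×-⇔ truth ψ x) (∋-∧ x)
  truth (φ ∨ ψ) x = ⇔.trans (truth φ x ⊎-⇔ truth ψ x) (∋-∨ x)
  truth (φ ⇒ ψ) = truth-⇒ (truth φ) (truth ψ)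
  truth (φ ▷ ψ) = truth-▷ (truth φ) (truth ψ)

  complete : ∀ {φ} → (∀ F → StrictFrame F → Valid F φ) → Thm φ
  complete {φ} valid =
    theorem (derivable-from-extensions λ x _ →
      to (truth φ x) (valid canonical canonical-strict V x))

decide : ExcludedMiddle (Level.suc 0ℓ) → (A : Set) → Dec A
decide lem A = map′ lower lift (lem {Lift _ A})

proposition5p6 : ∀ (φ : Formula) →
    (ICK⊕ Γ-strict ⊢ φ → ∀ (F : CKFrame) → StrictFrame F → Valid F φ)
    × (ExcludedMiddle (Level.suc Level.zero) →
       (∀ (F : CKFrame) → StrictFrame F → Valid F φ) → ICK⊕ Γ-strict ⊢ φ)
proposition5p6 φ = strict-sound , λ lem → Completeness.complete (decide lem)
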